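{- Every $c$-epichristoffel word is primitive and can be written as the product $uv$ of two palindromic words $u,v$.
   Context: $\mathcal{A}$ is a finite alphabet. A word is primitive if it is not of the form $x^n$ with $n\ge2$; a palindrome is a word equal to its reversal (the empty word counts as a palindrome). For $a,b\in\mathcal{A}$: $\psi_a(a)=\overline{\psi}_a(a)=a$, $\psi_a(x)=ax$, $\overline{\psi}_a(x)=xa$ for letters $x\neq a$, and $\theta_{ab}$ swaps $a$ and $b$ and fixes the other letters. Episturmian morphisms are the elements of the monoid generated by all $\psi_a,\overline{\psi}_a,\theta_{ab}$. A finite word is $c$-epichristoffel if it is the image of a letter under an episturmian morphism. -}

module Defs where

open import Data.Nat using (ℕ; zero; suc; _≥_)
open import Data.Fin using (Fin)
open import Data.Fin.Properties using (_≟_)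
open import Data.List using (List; []; _∷_; _++_; [_]; concatMap; reverse; foldr)
open import Data.Product using (∃; ∃-syntax; _×_)
open import Relation.Binary.PropositionalEquality using (_≡_)
open import Relation.Nullary using (¬_; yes; no)

Word : ℕ → Set
Word k = List (Fin k)

_^_ : ∀ {k} → Word k → ℕ → Word k
x ^ zero  = []
x ^ suc n = x ++ (x ^ n)

Primitive : ∀ {k} → Word k → Set
Primitive {k} w = ¬ (∃[ x ] ∃[ n ] (n ≥ 2 × w ≡ x ^ n))

Palindrome : ∀ {k} → Word k → Set
Palindrome w = reverse w ≡ w

data Gen (k : ℕ) : Set where
  ψ    : Fin k → Gen k
  ψbar : Fin k → Gen k
  θ    : Fin k → Fin k → Gen k

genLetter : ∀ {k} → Gen k → Fin k → Word k
genLetter (ψ a) x with x ≟ a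
... | yes _ = a ∷ []
... | no  _ = a ∷ x ∷ []
genLetter (ψbar a) x with x ≟ a
... | yes _ = a ∷ []
... | no  _ = x ∷ a ∷ []
genLetter (θ a b) x with x ≟ a | x ≟ b
... | yes _ | _     = b ∷ []
... | no  _ | yes _ = a ∷ []
... | no  _ | no  _ = x ∷ []

genApply : ∀ {k} → Gen k → Word k → Word k
genApply g = concatMap (genLetter g)

-- An episturmian morphism is a finite composition of generators:
-- the list g₁ ∷ … ∷ gₙ denotes g₁ ∘ … ∘ gₙ (the empty list is the identity).
EpiMorphism : ℕ → Set
EpiMorphism k = List (Gen k)

applyEpi : ∀ {k} → EpiMorphism k → Word k → Word k
applyEpi fs w = foldr genApply w fs

CEpichristoffel : ∀ {k} → Word k → Set
CEpichristoffel {k} w = ∃[ f ] ∃[ c ] (w ≡ applyEpi {k} f [ c ])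

module Submission where

-- Call w a palindromic product if w = uv with
-- u, v palindromes.  This property is preserved by every generator: θ_ab
-- maps palindromes to palindromes (it maps letters to letters); for ψ_a, if
-- v ≠ ε then ψ_a(uv) = (ψ_a(u)a)·Y with ψ_a(v) = aY, and both factors are
-- palindromes because reversal turns ψ_a into ψ̄_a and ψ_a(u)a = aψ̄_a(u);
-- ψ̄_a is ψ_a conjugated by reversal.  A letter c = c·ε is such a product.
--
-- A weight is an additive map g : Word → ℤ determined by its
-- values on letters.  For every generator G, every weight is the pullback
-- along G of some weight; hence if every weight of G(w) is divisible by n,
-- so is every weight of w.  Every weight of a power x^n is divisible by n,
-- while the letter c has weight 1 under the constant weight 1; so f(c) = x^n
-- forces n ∣ 1, i.e. n = 1.

open import Defs
open import Data.Nat using (ℕ; zero; suc; s≤s; _≥_)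
open import Data.Nat.Divisibility using (_∣_; m∣m*n; ∣1⇒≡1)
open import Data.Integer using (ℤ; +_; 0ℤ; 1ℤ; _+_; _-_; _*_; ∣_∣)
open import Data.Integer.Properties using (+-identityˡ; +-identityʳ; abs-*)
open import Data.Integer.Solver using (module +-*-Solver)
open import Data.List using ([]; _∷_; _++_; [_]; reverse; concatMap)
open import Data.List.Properties
  using (++-assoc; ++-identityʳ; reverse-++; reverse-involutive; concatMap-cong; concatMap-++; ∷-injectiveʳ; ∷ʳ-injectiveˡ)
open import Data.Fin using (Fin)
open import Data.Fin.Properties using (_≟_)
open import Data.Product using (∃-syntax; _×_; _,_)
open import Data.Empty using (⊥-elim)
open import Function using (_∘_)
open import Relation.Binary.PropositionalEquality
  using (_≡_; refl; sym; trans; cong; cong₂; subst; module ≡-Reasoning)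
open import Relation.Nullary using (¬_; yes; no)

open +-*-Solver using (solve; _:+_; _:-_; _:*_; _:=_; con)

reverse-concatMap : ∀ {k} (h : Fin k → Word k) w →
  reverse (concatMap h w) ≡ concatMap (reverse ∘ h) (reverse w)
reverse-concatMap h [] = refl
reverse-concatMap h (x ∷ w) = begin
  reverse (h x ++ concatMap h w)                        ≡⟨ reverse-++ (h x) (concatMap h w) ⟩
  reverse (concatMap h w) ++ reverse (h x)              ≡⟨ cong₂ _++_ (reverse-concatMap h w) (sym (++-identityʳ _)) ⟩
  concatMap (reverse ∘ h) (reverse w) ++ concatMap (reverse ∘ h) [ x ]
                                                        ≡⟨ sym (concatMap-++ (reverse ∘ h) (reverse w) [ x ]) ⟩
  concatMap (reverse ∘ h) (reverse w ++ [ x ])          ≡⟨ cong (concatMap (reverse ∘ h)) (sym (reverse-++ [ x ] w)) ⟩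
  concatMap (reverse ∘ h) (reverse (x ∷ w))             ∎
  where open ≡-Reasoning

concatMap-palindrome : ∀ {k} (h : Fin k → Word k) → (∀ x → Palindrome (h x)) →
  ∀ w → Palindrome w → Palindrome (concatMap h w)
concatMap-palindrome h hpal w wpal = begin
  reverse (concatMap h w)             ≡⟨ reverse-concatMap h w ⟩
  concatMap (reverse ∘ h) (reverse w) ≡⟨ concatMap-cong hpal (reverse w) ⟩
  concatMap h (reverse w)             ≡⟨ cong (concatMap h) wpal ⟩
  concatMap h w                       ∎
  where open ≡-Reasoning

PalProduct : ∀ {k} → Word k → Set
PalProduct w = ∃[ u ] ∃[ v ] (Palindrome u × Palindrome v × w ≡ u ++ v)

reverse-PalProduct : ∀ {k} (w : Word k) → PalProduct w → PalProduct (reverse w)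
reverse-PalProduct _ (u , v , pu , pv , refl) =
  v , u , pv , pu , trans (reverse-++ u v) (cong₂ _++_ pv pu)

ψ̂ ψ̄ : ∀ {k} → Fin k → Word k → Word k
ψ̂ a = genApply (ψ a)
ψ̄ a = genApply (ψbar a)

reverse-ψ : ∀ {k} (a : Fin k) w → reverse (ψ̂ a w) ≡ ψ̄ a (reverse w)
reverse-ψ a w = trans (reverse-concatMap (genLetter (ψ a)) w) (concatMap-cong reverse-letter (reverse w))
  where
  reverse-letter : ∀ x → reverse (genLetter (ψ a) x) ≡ genLetter (ψbar a) x
  reverse-letter x with x ≟ a
  ... | yes _ = refl
  ... | no _ = refl

ψ̄-via-ψ : ∀ {k} (a : Fin k) w → ψ̄ a w ≡ reverse (ψ̂ a (reverse w))
ψ̄-via-ψ a w = begin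
  ψ̄ a w                     ≡⟨ cong (ψ̄ a) (sym (reverse-involutive w)) ⟩
  ψ̄ a (reverse (reverse w)) ≡⟨ sym (reverse-ψ a (reverse w)) ⟩
  reverse (ψ̂ a (reverse w)) ∎
  where open ≡-Reasoning

ψ-conjugate : ∀ {k} (a : Fin k) w → ψ̂ a w ++ [ a ] ≡ a ∷ ψ̄ a w
ψ-conjugate a [] = refl
ψ-conjugate a (x ∷ w) with x ≟ a
... | yes _ = cong (a ∷_) (ψ-conjugate a w)
... | no _ = cong (λ t → a ∷ x ∷ t) (ψ-conjugate a w)

ψ-head : ∀ {k} (a x : Fin k) v → ∃[ Y ] (ψ̂ a (x ∷ v) ≡ a ∷ Y)
ψ-head a x v with x ≟ a
... | yes _ = ψ̂ a v , refl
... | no _ = x ∷ ψ̂ a v , refl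

ψ-palindrome-append : ∀ {k} (a : Fin k) u → Palindrome u → Palindrome (ψ̂ a u ++ [ a ])
ψ-palindrome-append a u pu = begin
  reverse (ψ̂ a u ++ [ a ]) ≡⟨ reverse-++ (ψ̂ a u) [ a ] ⟩
  a ∷ reverse (ψ̂ a u)      ≡⟨ cong (a ∷_) (reverse-ψ a u) ⟩
  a ∷ ψ̄ a (reverse u)      ≡⟨ cong (λ t → a ∷ ψ̄ a t) pu ⟩
  a ∷ ψ̄ a u                ≡⟨ sym (ψ-conjugate a u) ⟩
  ψ̂ a u ++ [ a ]           ∎
  where open ≡-Reasoning

-- If v is a palindrome and ψ_a(v) = aY, then Y is a palindrome:
-- both Y·a and reverse(Y)·a equal ψ̄_a(v).
ψ-palindrome-tail : ∀ {k} (a : Fin k) v Y → Palindrome v → ψ̂ a v ≡ a ∷ Y → Palindrome Y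
ψ-palindrome-tail a v Y pv ψv≡aY = ∷ʳ-injectiveˡ (reverse Y) Y (trans reverseY·a (sym Y·a))
  where
  open ≡-Reasoning
  reverseY·a : reverse Y ++ [ a ] ≡ ψ̄ a v
  reverseY·a = begin
    reverse Y ++ [ a ]  ≡⟨ sym (reverse-++ [ a ] Y) ⟩
    reverse (a ∷ Y)     ≡⟨ cong reverse (sym ψv≡aY) ⟩
    reverse (ψ̂ a v)     ≡⟨ reverse-ψ a v ⟩
    ψ̄ a (reverse v)     ≡⟨ cong (ψ̄ a) pv ⟩
    ψ̄ a v               ∎
  Y·a : Y ++ [ a ] ≡ ψ̄ a v
  Y·a = ∷-injectiveʳ (trans (cong (_++ [ a ]) (sym ψv≡aY)) (ψ-conjugate a v))

-- ψ_a(u·xv′) = (ψ_a(u)·a)·Y where ψ_a(xv′) = aY: a palindromic product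
-- whenever u and xv′ are palindromes.
ψ-PalProduct-nonempty : ∀ {k} (a : Fin k) u x v → Palindrome u → Palindrome (x ∷ v) →
  PalProduct (ψ̂ a (u ++ x ∷ v))
ψ-PalProduct-nonempty a u x v pu pv with ψ-head a x v
... | Y , ψv≡aY =
  ψ̂ a u ++ [ a ] , Y , ψ-palindrome-append a u pu , ψ-palindrome-tail a (x ∷ v) Y pv ψv≡aY ,
  (begin
    ψ̂ a (u ++ x ∷ v)         ≡⟨ concatMap-++ (genLetter (ψ a)) u (x ∷ v) ⟩
    ψ̂ a u ++ ψ̂ a (x ∷ v)     ≡⟨ cong (ψ̂ a u ++_) ψv≡aY ⟩
    ψ̂ a u ++ a ∷ Y           ≡⟨ sym (++-assoc (ψ̂ a u) [ a ] Y) ⟩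
    (ψ̂ a u ++ [ a ]) ++ Y    ∎)
  where open ≡-Reasoning

-- ψ_a preserves palindromic products; a product u·ε with u ≠ ε is first
-- rewritten as ε·u so that the right factor is nonempty.
ψ-PalProduct : ∀ {k} (a : Fin k) w → PalProduct w → PalProduct (ψ̂ a w)
ψ-PalProduct a _ (u , x ∷ v , pu , pv , refl) = ψ-PalProduct-nonempty a u x v pu pv
ψ-PalProduct a _ ([] , [] , _ , _ , refl) = [] , [] , refl , refl , refl
ψ-PalProduct a _ (x ∷ u , [] , pu , _ , refl) =
  subst (PalProduct ∘ ψ̂ a) (sym (++-identityʳ (x ∷ u))) (ψ-PalProduct-nonempty a [] x u refl pu)

-- ψ̄_a preserves palindromic products, by conjugating ψ_a with reversal.
ψ̄-PalProduct : ∀ {k} (a : Fin k) w → PalProduct w → PalProduct (ψ̄ a w)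
ψ̄-PalProduct a w p = subst PalProduct (sym (ψ̄-via-ψ a w))
  (reverse-PalProduct _ (ψ-PalProduct a (reverse w) (reverse-PalProduct w p)))

-- θ_ab maps letters to letters, so it preserves palindromes and products.
θ-PalProduct : ∀ {k} (a b : Fin k) w → PalProduct w → PalProduct (genApply (θ a b) w)
θ-PalProduct a b _ (u , v , pu , pv , refl) =
  θab u , θab v , concatMap-palindrome θ-letter θ-letter-palindrome u pu ,
  concatMap-palindrome θ-letter θ-letter-palindrome v pv , concatMap-++ θ-letter u v
  where
  θ-letter : Fin _ → Word _
  θ-letter = genLetter (θ a b)
  θab : Word _ → Word _
  θab = genApply (θ a b)
  θ-letter-palindrome : ∀ x → Palindrome (θ-letter x)
  θ-letter-palindrome x with x ≟ a | x ≟ b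
  ... | yes _ | _ = refl
  ... | no _ | yes _ = refl
  ... | no _ | no _ = refl

episturmian-PalProduct : ∀ {k} (f : EpiMorphism k) w → PalProduct w → PalProduct (applyEpi f w)
episturmian-PalProduct [] w p = p
episturmian-PalProduct (g ∷ f) w p = generator g (applyEpi f w) (episturmian-PalProduct f w p)
  where
  generator : ∀ g w → PalProduct w → PalProduct (genApply g w)
  generator (ψ a) = ψ-PalProduct a
  generator (ψbar a) = ψ̄-PalProduct a
  generator (θ a b) = θ-PalProduct a b

weight : ∀ {k} → (Fin k → ℤ) → Word k → ℤ
weight f [] = 0ℤ
weight f (x ∷ w) = f x + weight f w

weight-++ : ∀ {k} (f : Fin k → ℤ) u v → weight f (u ++ v) ≡ weight f u + weight f v
weight-++ f [] v = sym (+-identityˡ (weight f v))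
weight-++ f (x ∷ u) v = begin
  f x + weight f (u ++ v)            ≡⟨ cong (λ t → f x + t) (weight-++ f u v) ⟩
  f x + (weight f u + weight f v)    ≡⟨ solve 3 (λ p q r → p :+ (q :+ r) := (p :+ q) :+ r) refl (f x) _ _ ⟩
  (f x + weight f u) + weight f v    ∎
  where open ≡-Reasoning

weight-concatMap : ∀ {k} (f : Fin k → ℤ) (h : Fin k → Word k) w →
  weight f (concatMap h w) ≡ weight (weight f ∘ h) w
weight-concatMap f h [] = refl
weight-concatMap f h (x ∷ w) =
  trans (weight-++ f (h x) (concatMap h w)) (cong (λ t → weight f (h x) + t) (weight-concatMap f h w))

weight-cong : ∀ {k} {f g : Fin k → ℤ} → (∀ x → f x ≡ g x) → ∀ w → weight f w ≡ weight g w
weight-cong f≗g [] = refl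
weight-cong f≗g (x ∷ w) = cong₂ _+_ (f≗g x) (weight-cong f≗g w)

weight-^ : ∀ {k} (f : Fin k → ℤ) x n → weight f (x ^ n) ≡ + n * weight f x
weight-^ f x zero = refl
weight-^ f x (suc n) = begin
  weight f (x ++ x ^ n)              ≡⟨ weight-++ f x (x ^ n) ⟩
  weight f x + weight f (x ^ n)      ≡⟨ cong (λ t → weight f x + t) (weight-^ f x n) ⟩
  weight f x + + n * weight f x      ≡⟨ solve 2 (λ y m → y :+ m :* y := (con 1ℤ :+ m) :* y) refl (weight f x) (+ n) ⟩
  + suc n * weight f x               ∎
  where open ≡-Reasoning

WeightsDivisibleBy : ∀ {k} → ℕ → Word k → Set
WeightsDivisibleBy n w = ∀ f → n ∣ ∣ weight f w ∣

^-WeightsDivisibleBy : ∀ {k} (x : Word k) n → WeightsDivisibleBy n (x ^ n)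
^-WeightsDivisibleBy x n f = subst (λ z → n ∣ ∣ z ∣) (sym (weight-^ f x n))
  (subst (n ∣_) (sym (abs-* (+ n) (weight f x))) (m∣m*n ∣ weight f x ∣))

WeightSurjective : ∀ {k} → (Fin k → Word k) → Set
WeightSurjective {k} h = ∀ (g : Fin k → ℤ) → ∃[ f ] (∀ x → weight f (h x) ≡ g x)

reflect-WeightsDivisibleBy : ∀ {k} {h : Fin k → Word k} → WeightSurjective h →
  ∀ n w → WeightsDivisibleBy n (concatMap h w) → WeightsDivisibleBy n w
reflect-WeightsDivisibleBy {h = h} surj n w div g with surj g
... | f , f∘h≡g = subst (λ z → n ∣ ∣ z ∣)
  (trans (weight-concatMap f h w) (weight-cong f∘h≡g w)) (div f)

-- ψ_a and ψ̄_a are weight-surjective: give a the weight g(a) and every other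
-- letter x the weight g(x) − g(a).
ψ-pullback : ∀ {k} → Fin k → (Fin k → ℤ) → Fin k → ℤ
ψ-pullback a g y with y ≟ a
... | yes _ = g a
... | no _ = g y - g a

ψ-pullback-a : ∀ {k} (a : Fin k) g → ψ-pullback a g a ≡ g a
ψ-pullback-a a g with a ≟ a
... | yes _ = refl
... | no a≢a = ⊥-elim (a≢a refl)

ψ-pullback-other : ∀ {k} (a x : Fin k) g → ¬ x ≡ a → ψ-pullback a g x ≡ g x - g a
ψ-pullback-other a x g x≢a with x ≟ a
... | yes x≡a = ⊥-elim (x≢a x≡a)
... | no _ = refl

ψ-weightSurjective : ∀ {k} (a : Fin k) → WeightSurjective (genLetter (ψ a))
ψ-weightSurjective a g = ψ-pullback a g , pullback
  where
  pullback : ∀ x → weight (ψ-pullback a g) (genLetter (ψ a) x) ≡ g x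
  pullback x with x ≟ a
  ... | yes refl = trans (+-identityʳ _) (ψ-pullback-a a g)
  ... | no x≢a = trans (cong₂ (λ s t → s + (t + 0ℤ)) (ψ-pullback-a a g) (ψ-pullback-other a x g x≢a))
                       (solve 2 (λ p q → p :+ ((q :- p) :+ con 0ℤ) := q) refl (g a) (g x))

ψ̄-weightSurjective : ∀ {k} (a : Fin k) → WeightSurjective (genLetter (ψbar a))
ψ̄-weightSurjective a g = ψ-pullback a g , pullback
  where
  pullback : ∀ x → weight (ψ-pullback a g) (genLetter (ψbar a) x) ≡ g x
  pullback x with x ≟ a
  ... | yes refl = trans (+-identityʳ _) (ψ-pullback-a a g)
  ... | no x≢a = trans (cong₂ (λ s t → s + (t + 0ℤ)) (ψ-pullback-other a x g x≢a) (ψ-pullback-a a g))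
                       (solve 2 (λ p q → (q :- p) :+ (p :+ con 0ℤ) := q) refl (g a) (g x))

θ-involutive : ∀ {k} (a b x : Fin k) → genApply (θ a b) (genLetter (θ a b) x) ≡ [ x ]
θ-involutive a b x with x ≟ a | x ≟ b
θ-involutive a b x | yes refl | _ with b ≟ x | b ≟ b
... | yes b≡x | _ = cong [_] b≡x
... | no _ | yes _ = refl
... | no _ | no b≢b = ⊥-elim (b≢b refl)
θ-involutive a b x | no _ | yes refl with a ≟ a
... | yes _ = refl
... | no a≢a = ⊥-elim (a≢a refl)
θ-involutive a b x | no x≢a | no x≢b with x ≟ a | x ≟ b
... | yes x≡a | _ = ⊥-elim (x≢a x≡a)
... | no _ | yes x≡b = ⊥-elim (x≢b x≡b)
... | no _ | no _ = refl

-- θ_ab is weight-surjective: pull g back along θ_ab itself.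
θ-weightSurjective : ∀ {k} (a b : Fin k) → WeightSurjective (genLetter (θ a b))
θ-weightSurjective a b g = weight g ∘ genLetter (θ a b) , λ x → begin
  weight (weight g ∘ genLetter (θ a b)) (genLetter (θ a b) x) ≡⟨ sym (weight-concatMap g (genLetter (θ a b)) (genLetter (θ a b) x)) ⟩
  weight g (genApply (θ a b) (genLetter (θ a b) x))           ≡⟨ cong (weight g) (θ-involutive a b x) ⟩
  g x + 0ℤ                                                    ≡⟨ +-identityʳ (g x) ⟩
  g x                                                         ∎
  where open ≡-Reasoning

episturmian-reflect-WeightsDivisibleBy : ∀ {k} n (f : EpiMorphism k) w →
  WeightsDivisibleBy n (applyEpi f w) → WeightsDivisibleBy n w
episturmian-reflect-WeightsDivisibleBy n [] w div = div
episturmian-reflect-WeightsDivisibleBy n (g ∷ f) w div =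
  episturmian-reflect-WeightsDivisibleBy n f w (reflect-WeightsDivisibleBy (generator g) n (applyEpi f w) div)
  where
  generator : ∀ g → WeightSurjective (genLetter g)
  generator (ψ a) = ψ-weightSurjective a
  generator (ψbar a) = ψ̄-weightSurjective a
  generator (θ a b) = θ-weightSurjective a b

-- If f(c) = x^n then n divides the weight 1 of c under the constant weighting.
CEpichristoffel-primitive : ∀ {k} (w : Word k) → CEpichristoffel w → Primitive w
CEpichristoffel-primitive _ (f , c , refl) (x , n , n≥2 , f[c]≡xⁿ) = n≢1 n≥2 (∣1⇒≡1 (c-divisible (λ _ → 1ℤ)))
  where
  c-divisible : WeightsDivisibleBy n [ c ]
  c-divisible = episturmian-reflect-WeightsDivisibleBy n f [ c ]
    (subst (WeightsDivisibleBy n) (sym f[c]≡xⁿ) (^-WeightsDivisibleBy x n))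
  n≢1 : ∀ {n} → n ≥ 2 → ¬ n ≡ 1
  n≢1 (s≤s ()) refl

proposition4p9 : (k : ℕ) → (w : Word k) → CEpichristoffel w →
    Primitive w × (∃[ u ] ∃[ v ] (Palindrome u × Palindrome v × w ≡ u ++ v))
proposition4p9 _ w (f , c , w≡f[c]) =
  CEpichristoffel-primitive w (f , c , w≡f[c]) ,
  subst PalProduct (sym w≡f[c]) (episturmian-PalProduct f [ c ] letter-PalProduct)
  where
  letter-PalProduct : PalProduct [ c ]
  letter-PalProduct = [ c ] , [] , refl , refl , refl
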